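{- Let $G=(V,E)$ be a finite undirected bi-connected graph with $n=|V|\ge 6$, and let $s_1,s_2\in V$ with $(s_1,s_2)\in E$. Let $C_1,\dots,C_k$ be the connected components of the graph obtained from $G$ by deleting $s_1$, $s_2$ and all edges incident to them. If $k>2$, then there is no partition $V=V_1\cup V_2$, $V_1\cap V_2=\emptyset$, with $s_1\in V_1$, $s_2\in V_2$, $|V_1|\ge 3$, $|V_2|\ge 3$, such that both induced subgraphs $G[V_1]$ and $G[V_2]$ are bi-connected.
   Context: A graph is bi-connected (2-connected) if it is connected and has no articulation point, i.e. no vertex whose removal disconnects it. For $V'\subseteq V$, $G[V']$ denotes the subgraph of $G$ induced by $V'$. -}

module Defs where

open import Data.Nat using (ℕ)
open import Data.Fin using (Fin)
open import Data.Fin.Subset using (Subset; _∈_; _∉_; _-_; ⊤; ∁; ⁅_⁆; _∪_)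
open import Data.Product using (_×_; Σ-syntax)
open import Relation.Nullary using (¬_)
open import Relation.Binary.PropositionalEquality using (_≡_)
open import Level using (suc; zero)

record Graph (n : ℕ) : Set₁ where
  field
    Adj     : Fin n → Fin n → Set
    sym     : ∀ {u v} → Adj u v → Adj v u
    irrefl  : ∀ {u} → ¬ Adj u u
open Graph public

data Walk {n : ℕ} (G : Graph n) (S : Subset n) : Fin n → Fin n → Set where
  nil  : ∀ {u} → u ∈ S → Walk G S u u
  cons : ∀ {u w v} → u ∈ S → Adj G u w → Walk G S w v → Walk G S u v

Connected : ∀ {n} → Graph n → Subset n → Set
Connected G S = ∀ u v → u ∈ S → v ∈ S → Walk G S u v

BiConnected : ∀ {n} → Graph n → Subset n → Set
BiConnected G S = Connected G S × (∀ w → w ∈ S → Connected G (S - w))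

-- The graph obtained from G by deleting s₁ and s₂ (and incident edges)
-- has more than two connected components (k > 2): there are three vertices
-- of it lying in pairwise distinct components.
MoreThanTwoComponents : ∀ {n} → Graph n → Fin n → Fin n → Set
MoreThanTwoComponents {n} G s₁ s₂ =
  Σ[ a ∈ Fin n ] Σ[ b ∈ Fin n ] Σ[ c ∈ Fin n ]
    (a ∈ R × b ∈ R × c ∈ R ×
     ¬ Walk G R a b × ¬ Walk G R a c × ¬ Walk G R b c)
  where
    R : Subset n
    R = ∁ (⁅ s₁ ⁆ ∪ ⁅ s₂ ⁆)

-- Deleting s₁ from G[V₁] and s₂ from G[V₂] leaves two connected graphs, by bi-connectivity
-- of the two sides. Their vertex sets V₁ ∖ {s₁} and V₂ ∖ {s₂} cover V ∖ {s₁, s₂}, so any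
-- three of its vertices include two joined by a walk avoiding s₁ and s₂, and hence
-- G − {s₁, s₂} has at most two components.
module Submission where

open import Defs
open import Data.Nat using (ℕ; _≤_)
open import Data.Fin using (Fin)
open import Data.Fin.Subset using (Subset; _∈_; _∉_; ⊤; ∁; ∣_∣; _─_; _-_; ⁅_⁆; _∪_; _⊆_; inside; outside)
open import Data.Fin.Subset.Properties
  using (_∈?_; x∈p⇒x∉∁p; x∈∁p⇒x∉p; x∉p⇒x∈∁p; x∈⁅x⁆; x≢y⇒x∉⁅y⁆; x∈p∪q⁻; x∈p∪q⁺; p─q⊆p; x∈p∧x≢y⇒x∈p-y)
open import Data.Vec.Base using (_∷_; here; there)
open import Data.Product using (_×_; _,_)
open import Data.Sum using (_⊎_; inj₁; inj₂; [_,_])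
open import Function using (_∘_)
open import Relation.Nullary using (¬_; yes; no)
open import Relation.Binary.PropositionalEquality using (_≢_; refl)

private
  variable
    n : ℕ

x∈p─q⇒x∉q : ∀ {x : Fin n} (p q : Subset n) → x ∈ p ─ q → x ∉ q
x∈p─q⇒x∉q (_ ∷ p) (inside  ∷ q) (there x∈p─q) (there x∈q) = x∈p─q⇒x∉q p q x∈p─q x∈q
x∈p─q⇒x∉q (_ ∷ p) (outside ∷ q) (there x∈p─q) (there x∈q) = x∈p─q⇒x∉q p q x∈p─q x∈q

x∈p-y⇒x≢y : ∀ {x y : Fin n} (p : Subset n) → x ∈ p - y → x ≢ y
x∈p-y⇒x≢y {y = y} p x∈p-y refl = x∈p─q⇒x∉q p ⁅ y ⁆ x∈p-y (x∈⁅x⁆ y)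

x∈∁[p∪q]⁻ : ∀ {x : Fin n} (p q : Subset n) → x ∈ ∁ (p ∪ q) → x ∉ p × x ∉ q
x∈∁[p∪q]⁻ p q x∈∁[p∪q] =
  (x∈∁p⇒x∉p x∈∁[p∪q] ∘ x∈p∪q⁺ ∘ inj₁) , (x∈∁p⇒x∉p x∈∁[p∪q] ∘ x∈p∪q⁺ ∘ inj₂)

x∈∁[p∪q]⁺ : ∀ {x : Fin n} (p q : Subset n) → x ∉ p → x ∉ q → x ∈ ∁ (p ∪ q)
x∈∁[p∪q]⁺ p q x∉p x∉q = x∉p⇒x∈∁p ([ x∉p , x∉q ] ∘ x∈p∪q⁻ p q)

x∈∁⁅s⁆∪⁅t⁆⁻ : ∀ {x s t : Fin n} → x ∈ ∁ (⁅ s ⁆ ∪ ⁅ t ⁆) → x ≢ s × x ≢ t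
x∈∁⁅s⁆∪⁅t⁆⁻ {s = s} {t} x∈ with x∈∁[p∪q]⁻ ⁅ s ⁆ ⁅ t ⁆ x∈
... | x∉⁅s⁆ , x∉⁅t⁆ = (λ { refl → x∉⁅s⁆ (x∈⁅x⁆ s) }) , (λ { refl → x∉⁅t⁆ (x∈⁅x⁆ t) })

x∈∁⁅s⁆∪⁅t⁆⁺ : ∀ {x s t : Fin n} → x ≢ s → x ≢ t → x ∈ ∁ (⁅ s ⁆ ∪ ⁅ t ⁆)
x∈∁⁅s⁆∪⁅t⁆⁺ {s = s} {t} x≢s x≢t = x∈∁[p∪q]⁺ ⁅ s ⁆ ⁅ t ⁆ (x≢y⇒x∉⁅y⁆ x≢s) (x≢y⇒x∉⁅y⁆ x≢t)

x∈p∧y∉p⇒x≢y : ∀ {x y : Fin n} {p : Subset n} → x ∈ p → y ∉ p → x ≢ y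
x∈p∧y∉p⇒x≢y x∈p y∉p refl = y∉p x∈p

x≢s×x≢t⇒x∈p-s⊎x∈∁p-t : ∀ {x s t : Fin n} (p : Subset n) → x ≢ s → x ≢ t →
                        x ∈ p - s ⊎ x ∈ ∁ p - t
x≢s×x≢t⇒x∈p-s⊎x∈∁p-t {x = x} p x≢s x≢t with x ∈? p
... | yes x∈p = inj₁ (x∈p∧x≢y⇒x∈p-y x∈p x≢s)
... | no  x∉p = inj₂ (x∈p∧x≢y⇒x∈p-y (x∉p⇒x∈∁p x∉p) x≢t)

Walk-mono : ∀ {G : Graph n} {S T : Subset n} → S ⊆ T → ∀ {u v} → Walk G S u v → Walk G T u v
Walk-mono S⊆T (nil u∈S)          = nil (S⊆T u∈S)
Walk-mono S⊆T (cons u∈S uw walk) = cons (S⊆T u∈S) uw (Walk-mono S⊆T walk)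

BiConnected⇒walk-avoiding : ∀ {G : Graph n} {S T : Subset n} {s u v} →
                            BiConnected G S → s ∈ S → S - s ⊆ T →
                            u ∈ S - s → v ∈ S - s → Walk G T u v
BiConnected⇒walk-avoiding (_ , cut-connected) s∈S S-s⊆T u∈ v∈ =
  Walk-mono S-s⊆T (cut-connected _ s∈S _ _ u∈ v∈)

two-of-three-on-one-side : ∀ {a} {A : Set a} {P Q : A → Set} {R : A → A → Set} →
                           (∀ {x y} → P x → P y → R x y) → (∀ {x y} → Q x → Q y → R x y) →
                           ∀ {x y z} → P x ⊎ Q x → P y ⊎ Q y → P z ⊎ Q z →
                           R x y ⊎ R x z ⊎ R y z
two-of-three-on-one-side onP onQ (inj₁ px) (inj₁ py) _         = inj₁ (onP px py)
two-of-three-on-one-side onP onQ (inj₂ qx) (inj₂ qy) _         = inj₁ (onQ qx qy)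
two-of-three-on-one-side onP onQ (inj₁ px) (inj₂ _)  (inj₁ pz) = inj₂ (inj₁ (onP px pz))
two-of-three-on-one-side onP onQ (inj₂ qx) (inj₁ _)  (inj₂ qz) = inj₂ (inj₁ (onQ qx qz))
two-of-three-on-one-side onP onQ (inj₁ _)  (inj₂ qy) (inj₂ qz) = inj₂ (inj₂ (onQ qy qz))
two-of-three-on-one-side onP onQ (inj₂ _)  (inj₁ py) (inj₁ pz) = inj₂ (inj₂ (onP py pz))

lemma1 : (n : ℕ) → (G : Graph n) → 6 ≤ n → BiConnected G ⊤ →
         (s₁ s₂ : Fin n) → Adj G s₁ s₂ →
         MoreThanTwoComponents G s₁ s₂ →
         (V₁ : Subset n) → s₁ ∈ V₁ → s₂ ∈ ∁ V₁ →
         3 ≤ ∣ V₁ ∣ → 3 ≤ ∣ ∁ V₁ ∣ →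
         ¬ (BiConnected G V₁ × BiConnected G (∁ V₁))
lemma1 n G _ _ s₁ s₂ _ (a , b , c , a∈R , b∈R , c∈R , ¬ab , ¬ac , ¬bc)
       V₁ s₁∈V₁ s₂∈V₂ _ _ (bi₁ , bi₂)
  = [ ¬ab , [ ¬ac , ¬bc ] ]
      (two-of-three-on-one-side {R = Walk G R}
        (BiConnected⇒walk-avoiding bi₁ s₁∈V₁ V₁-s₁⊆R)
        (BiConnected⇒walk-avoiding bi₂ s₂∈V₂ V₂-s₂⊆R)
        (side a∈R) (side b∈R) (side c∈R))
  where
  R : Subset n
  R = ∁ (⁅ s₁ ⁆ ∪ ⁅ s₂ ⁆)
  V₁-s₁⊆R : V₁ - s₁ ⊆ R
  V₁-s₁⊆R x∈ = x∈∁⁅s⁆∪⁅t⁆⁺ (x∈p-y⇒x≢y V₁ x∈)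
                            (x∈p∧y∉p⇒x≢y (p─q⊆p V₁ ⁅ s₁ ⁆ x∈) (x∈∁p⇒x∉p s₂∈V₂))
  V₂-s₂⊆R : ∁ V₁ - s₂ ⊆ R
  V₂-s₂⊆R x∈ = x∈∁⁅s⁆∪⁅t⁆⁺ (x∈p∧y∉p⇒x≢y (p─q⊆p (∁ V₁) ⁅ s₂ ⁆ x∈) (x∈p⇒x∉∁p s₁∈V₁))
                            (x∈p-y⇒x≢y (∁ V₁) x∈)
  side : ∀ {x} → x ∈ R → x ∈ V₁ - s₁ ⊎ x ∈ ∁ V₁ - s₂
  side x∈R = let x≢s₁ , x≢s₂ = x∈∁⁅s⁆∪⁅t⁆⁻ x∈R
             in x≢s×x≢t⇒x∈p-s⊎x∈∁p-t V₁ x≢s₁ x≢s₂
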